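{- Let $L\ge 1$ and $1\le m\le 2^L$ be integers, let $(\beta_1,\dots,\beta_{2^L})$ be a Cantor basis of ${\rm GF}(2^{2^L})$ over ${\rm GF}(2)$, and let $W_i$, $\varpi_u$ be as in the context. There is an algorithm (the evaluation algorithm) which, given $a\in W_{2^L}\setminus W_m$ and a polynomial $f$ over ${\rm GF}(2^{2^L})$ of degree $<2^m$, outputs $(v_0,\dots,v_{2^m-1})$ with $v_i=f(a+\varpi_i)$, and which uses at most $2^{m-1}m$ multiplications in ${\rm GF}(2^{2^L})$.
   Context: A Cantor basis of ${\rm GF}(2^{2^L})$ over ${\rm GF}(2)$ is a ${\rm GF}(2)$-basis $(\beta_1,\dots,\beta_{2^L})$ with $\beta_1=1$ and $\beta_i^2-\beta_i=\beta_{i-1}$ for $i>1$. $W_i=\sum_{t=1}^i{\rm GF}(2)\beta_t$. For $0\le u<2^{2^L}$ with binary digits $u=\sum_t u_t2^t$, $\varpi_u=\sum_t u_t\beta_{t+1}$. -}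

module Defs where

open import Level using (Level; _⊔_)
open import Algebra.Bundles using (CommutativeRing)
open import Data.Nat using (ℕ; zero; suc; _≤_; ⌊_/2⌋)
import Data.Nat as N
open import Data.Bool using (Bool; true; false; if_then_else_)
open import Data.Fin using (Fin; toℕ; inject₁; fromℕ)
import Data.Fin as F
open import Data.Product using (Σ; _×_; ∃)
open import Data.Vec using (Vec; []; _∷_; lookup)
open import Relation.Binary.PropositionalEquality using (_≡_)
open import Relation.Nullary using (¬_)
import Data.Nat.Properties
import Relation.Nullary

odd? : ℕ → Bool
odd? zero = false
odd? (suc zero) = true
odd? (suc (suc n)) = odd? n

bit : ℕ → ℕ → Bool
bit zero u = odd? u
bit (suc t) u = bit t ⌊ u /2⌋

module _ {c ℓ : Level} (R : CommutativeRing c ℓ) where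
  open CommutativeRing R

  sumF : (n : ℕ) → (Fin n → Carrier) → Carrier
  sumF zero g = 0#
  sumF (suc n) g = g F.zero + sumF n (λ t → g (F.suc t))

  pow : Carrier → ℕ → Carrier
  pow x zero = 1#
  pow x (suc j) = x * pow x j

  IsField : Set (c ⊔ ℓ)
  IsField = (¬ (1# ≈ 0#)) × (∀ x → ¬ (x ≈ 0#) → Σ Carrier (λ y → (x * y) ≈ 1#))

  Char2 : Set ℓ
  Char2 = (1# + 1#) ≈ 0#

  lincomb : (n : ℕ) → (Fin n → Bool) → (Fin n → Carrier) → Carrier
  lincomb n cs b = sumF n (λ t → if cs t then b t else 0#)

  IsGF2Basis : (n : ℕ) → (Fin n → Carrier) → Set (c ⊔ ℓ)
  IsGF2Basis n b =
    (∀ (cs : Fin n → Bool) → lincomb n cs b ≈ 0# → ∀ t → cs t ≡ false)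
    × (∀ x → Σ (Fin n → Bool) (λ cs → x ≈ lincomb n cs b))

  -- Cantor basis (indexed from 0): β 0 = 1, β (t+1)^2 - β (t+1) = β t
  IsCantorBasis : (N : ℕ) → (Fin N → Carrier) → Set (c ⊔ ℓ)
  IsCantorBasis N β =
    IsGF2Basis N β
    × (∀ (h : 0 N.< N) → β (F.fromℕ< h) ≈ 1#)
    × (∀ (t : ℕ) (h : suc t N.< N) →
         ((β (F.fromℕ< h) * β (F.fromℕ< h)) - β (F.fromℕ< h))
           ≈ β (F.fromℕ< (Data.Nat.Properties.<-trans (Data.Nat.Properties.n<1+n t) h)))

  -- W_i = Σ_{t=1}^i GF(2) β_t  (0-indexed: coordinates t < i)
  W : (N : ℕ) → (Fin N → Carrier) → ℕ → Carrier → Set ℓ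
  W N β i x = Σ (Fin N → Bool) (λ cs → (∀ t → i ≤ toℕ t → cs t ≡ false) × (x ≈ lincomb N cs β))

  -- ϖ_u = Σ_t u_t β_{t+1}
  varpi : (N : ℕ) → (Fin N → Carrier) → ℕ → Carrier
  varpi N β u = lincomb N (λ t → bit (toℕ t) u) β

  evalPoly : (d : ℕ) → (Fin d → Carrier) → Carrier → Carrier
  evalPoly d f x = sumF d (λ j → f j * pow x (toℕ j))

  -- Straight-line programs over R (algebraic model of computation):
  -- registers 0..k-1 hold the inputs; each instruction appends one register.
  data Op (n : ℕ) : Set c where
    const : Carrier → Op n
    add   : Fin n → Fin n → Op n
    sub   : Fin n → Fin n → Op n
    mul   : Fin n → Fin n → Op n

  data Prog (k : ℕ) : ℕ → Set c where
    start : Prog k k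
    _▷_   : ∀ {n} → Prog k n → Op n → Prog k (suc n)

  opVal : ∀ {n} → Op n → (Fin n → Carrier) → Carrier
  opVal (const a) r = a
  opVal (add i j) r = r i + r j
  opVal (sub i j) r = r i - r j
  opVal (mul i j) r = r i * r j

  opMuls : ∀ {n} → Op n → ℕ
  opMuls (mul _ _) = 1
  opMuls _ = 0

  snocF : ∀ {n} → (Fin n → Carrier) → Carrier → Fin (suc n) → Carrier
  snocF {n} r a i with toℕ i Data.Nat.<? n
  ... | Relation.Nullary.yes p = r (F.fromℕ< p)
  ... | Relation.Nullary.no _ = a

  run : ∀ {k n} → Prog k n → (Fin k → Carrier) → Fin n → Carrier
  run start inp = inp
  run (p ▷ o) inp = snocF (run p inp) (opVal o (run p inp))

  mulCount : ∀ {k n} → Prog k n → ℕ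
  mulCount start = 0
  mulCount (p ▷ o) = mulCount p N.+ opMuls o

-- Write ℘ x = x² + x, the Artin–Schreier map in characteristic 2. A polynomial f with 2d coefficients
-- splits as f(x) = g₀(℘ x) + x·g₁(℘ x) with g₀, g₁ of d coefficients each, using additions only (a
-- Taylor expansion at x² + x). Since ℘ is additive and ℘ β_{i+1} = β_i, ℘ maps the 2^(m+1) points
-- a + ϖ_u two-to-one onto the 2^m points ℘ a + ϖ_u of the next smaller Cantor coset, the two preimages
-- of a point differing by β₁ = 1. So after evaluating g₀ and g₁ recursively there, f(x) = g₀ + x·g₁ and
-- f(x + 1) = f(x) + g₁ cost one multiplication per pair of points: C(m+1) = 2 C(m) + 2^m, whence
-- C(m) = 2^(m-1)·m.
module Submission where

open import Level using (Level; _⊔_)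
open import Algebra.Bundles using (CommutativeRing)
import Algebra.Properties.CommutativeSemigroup as CommutativeSemigroupProperties
open import Data.Bool using (true; false; if_then_else_)
open import Data.Empty using (⊥-elim)
open import Data.Fin as Fin using (Fin; toℕ; fromℕ; fromℕ<; inject₁; inject≤)
import Data.Fin.Properties as Finₚ
open import Data.Nat as ℕ using (ℕ; zero; suc; z≤n; s≤s; ⌊_/2⌋; _≤_; _<_)
import Data.Nat.Properties as ℕₚ
open import Data.Nat.Tactic.RingSolver using (solve-∀)
open import Data.Product using (Σ; _×_; _,_; proj₁)
open import Data.Unit.Polymorphic using (⊤)
open import Data.Vec as Vec using (Vec; []; _∷_; map; tabulate; allFin)
import Data.Vec.Properties as Vecₚ
open import Data.Vec.Relation.Binary.Pointwise.Inductive as Pointwise using (Pointwise; []; _∷_)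
open import Function using (_∘_)
open import Relation.Binary.PropositionalEquality as ≡ using (_≡_; _≗_; refl; cong; cong₂)
open import Relation.Nullary using (¬_; yes; no)
open import Defs

dbl : ℕ → ℕ
dbl zero = zero
dbl (suc n) = suc (suc (dbl n))

pow2 : ℕ → ℕ
pow2 zero = 1
pow2 (suc m) = dbl (pow2 m)

dbl≡2* : ∀ n → dbl n ≡ 2 ℕ.* n
dbl≡2* zero = refl
dbl≡2* (suc n) = ≡.trans (cong (suc ∘ suc) (dbl≡2* n)) (≡.sym (ℕₚ.*-suc 2 n))

pow2≡2^ : ∀ m → pow2 m ≡ 2 ℕ.^ m
pow2≡2^ zero = refl
pow2≡2^ (suc m) = ≡.trans (dbl≡2* (pow2 m)) (cong (2 ℕ.*_) (pow2≡2^ m))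

odd?-dbl : ∀ n → odd? (dbl n) ≡ false
odd?-dbl zero = refl
odd?-dbl (suc n) = odd?-dbl n

odd?-1+dbl : ∀ n → odd? (suc (dbl n)) ≡ true
odd?-1+dbl zero = refl
odd?-1+dbl (suc n) = odd?-1+dbl n

⌊dbl-n/2⌋≡n : ∀ n → ⌊ dbl n /2⌋ ≡ n
⌊dbl-n/2⌋≡n zero = refl
⌊dbl-n/2⌋≡n (suc n) = cong suc (⌊dbl-n/2⌋≡n n)

⌊1+dbl-n/2⌋≡n : ∀ n → ⌊ suc (dbl n) /2⌋ ≡ n
⌊1+dbl-n/2⌋≡n zero = refl
⌊1+dbl-n/2⌋≡n (suc n) = cong suc (⌊1+dbl-n/2⌋≡n n)

m<dbl-n⇒⌊m/2⌋<n : ∀ m n → m < dbl n → ⌊ m /2⌋ < n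
m<dbl-n⇒⌊m/2⌋<n zero (suc n) _ = s≤s z≤n
m<dbl-n⇒⌊m/2⌋<n (suc zero) (suc n) _ = s≤s z≤n
m<dbl-n⇒⌊m/2⌋<n (suc (suc m)) (suc n) (s≤s (s≤s m<n)) = s≤s (m<dbl-n⇒⌊m/2⌋<n m n m<n)

fftCost : ℕ → ℕ
fftCost zero = 0
fftCost (suc m) = fftCost m ℕ.+ (fftCost m ℕ.+ pow2 m)

fftCost-suc : ∀ m → fftCost (suc m) ≡ pow2 m ℕ.* suc m
fftCost-suc zero = refl
fftCost-suc (suc m) = begin
  fftCost (suc m) ℕ.+ (fftCost (suc m) ℕ.+ dbl (pow2 m))
    ≡⟨ cong₂ (λ x y → x ℕ.+ (x ℕ.+ y)) (fftCost-suc m) (dbl≡2* (pow2 m)) ⟩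
  pow2 m ℕ.* suc m ℕ.+ (pow2 m ℕ.* suc m ℕ.+ 2 ℕ.* pow2 m)
    ≡⟨ regroup (pow2 m) m ⟩
  2 ℕ.* pow2 m ℕ.* suc (suc m)
    ≡⟨ cong (ℕ._* suc (suc m)) (≡.sym (dbl≡2* (pow2 m))) ⟩
  dbl (pow2 m) ℕ.* suc (suc m) ∎
  where
  open ≡.≡-Reasoning
  regroup : ∀ P m → P ℕ.* suc m ℕ.+ (P ℕ.* suc m ℕ.+ 2 ℕ.* P) ≡ 2 ℕ.* P ℕ.* suc (suc m)
  regroup = solve-∀

fftCost≡ : ∀ m → fftCost m ≡ 2 ℕ.^ (m ℕ.∸ 1) ℕ.* m
fftCost≡ zero = refl
fftCost≡ (suc m) = ≡.trans (fftCost-suc m) (cong (ℕ._* suc m) (pow2≡2^ m))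

module _ {a} {A : Set a} where

  interleave : ∀ {n} → Vec A n → Vec A n → Vec A (dbl n)
  interleave [] [] = []
  interleave (x ∷ xs) (y ∷ ys) = x ∷ y ∷ interleave xs ys

  evens : ∀ {n} → Vec A (dbl n) → Vec A n
  evens {zero} [] = []
  evens {suc n} (x ∷ _ ∷ xs) = x ∷ evens xs

  odds : ∀ {n} → Vec A (dbl n) → Vec A n
  odds {zero} [] = []
  odds {suc n} (_ ∷ y ∷ xs) = y ∷ odds xs

  sample : (n : ℕ) → (ℕ → A) → Vec A n
  sample n p = tabulate (p ∘ toℕ)

  sample-dbl : ∀ n (p : ℕ → A) → sample (dbl n) p ≡ interleave (sample n (p ∘ dbl)) (sample n (p ∘ suc ∘ dbl))
  sample-dbl zero p = refl
  sample-dbl (suc n) p = cong (λ xs → p 0 ∷ p 1 ∷ xs) (sample-dbl n (p ∘ suc ∘ suc))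

module _ {a b} {A : Set a} {B : Set b} where

  map-sample : ∀ n (f : A → B) (p : ℕ → A) → map f (sample n p) ≡ sample n (f ∘ p)
  map-sample n f p = ≡.sym (Vecₚ.tabulate-∘ f (p ∘ toℕ))

  map-evens : ∀ {n} (f : A → B) (xs : Vec A (dbl n)) → map f (evens xs) ≡ evens (map f xs)
  map-evens {zero} f [] = refl
  map-evens {suc n} f (x ∷ _ ∷ xs) = cong (f x ∷_) (map-evens f xs)

  map-odds : ∀ {n} (f : A → B) (xs : Vec A (dbl n)) → map f (odds xs) ≡ odds (map f xs)
  map-odds {zero} f [] = refl
  map-odds {suc n} f (_ ∷ y ∷ xs) = cong (f y ∷_) (map-odds f xs)

  module _ {r} {_∼_ : A → B → Set r} where

    interleave⁺ : ∀ {n} {xs ys : Vec A n} {xs′ ys′ : Vec B n} →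
      Pointwise _∼_ xs xs′ → Pointwise _∼_ ys ys′ → Pointwise _∼_ (interleave xs ys) (interleave xs′ ys′)
    interleave⁺ [] [] = []
    interleave⁺ (x∼ ∷ xs∼) (y∼ ∷ ys∼) = x∼ ∷ y∼ ∷ interleave⁺ xs∼ ys∼

    sample⁺ : ∀ n {p : ℕ → A} {q : ℕ → B} → (∀ u → p u ∼ q u) → Pointwise _∼_ (sample n p) (sample n q)
    sample⁺ n p∼q = Pointwise.tabulate⁺ (p∼q ∘ toℕ)

module _ {c ℓ} (R : CommutativeRing c ℓ) where

  open CommutativeRing R renaming (refl to ≈-refl; sym to ≈-sym; trans to ≈-trans)
  open import Relation.Binary.Reasoning.Setoid setoid hiding (start)
  open import Algebra.Solver.Ring.NaturalCoefficients.Default commutativeSemiring using (solve; _:=_; _:+_; _:*_)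
  module +-CS = CommutativeSemigroupProperties +-commutativeSemigroup
  module *-CS = CommutativeSemigroupProperties *-commutativeSemigroup

  snocF-inject₁ : ∀ {n} (r : Fin n → Carrier) x i → snocF R r x (inject₁ i) ≡ r i
  snocF-inject₁ {n} r x i with toℕ (inject₁ i) ℕ.<? n
  ... | yes i<n = cong r (Finₚ.toℕ-injective (≡.trans (Finₚ.toℕ-fromℕ< i<n) (Finₚ.toℕ-inject₁ i)))
  ... | no i≮n = ⊥-elim (i≮n (≡.subst (_< n) (≡.sym (Finₚ.toℕ-inject₁ i)) (Finₚ.toℕ<n i)))

  snocF-last : ∀ {n} (r : Fin n → Carrier) x → snocF R r x (fromℕ n) ≡ x
  snocF-last {n} r x with toℕ (fromℕ n) ℕ.<? n
  ... | yes n<n = ⊥-elim (ℕₚ.<-irrefl (Finₚ.toℕ-fromℕ n) n<n)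
  ... | no _ = refl

  snocF-cong : ∀ {n} {r r′ : Fin n → Carrier} {x x′} → r ≗ r′ → x ≡ x′ → snocF R r x ≗ snocF R r′ x′
  snocF-cong {n} r≗r′ refl i with toℕ i ℕ.<? n
  ... | yes _ = r≗r′ _
  ... | no _ = refl

  opVal-cong : ∀ {n} (o : Op R n) {r r′ : Fin n → Carrier} → r ≗ r′ → opVal R o r ≡ opVal R o r′
  opVal-cong (const x) r≗r′ = refl
  opVal-cong (add i j) r≗r′ = cong₂ _+_ (r≗r′ i) (r≗r′ j)
  opVal-cong (sub i j) r≗r′ = cong₂ _-_ (r≗r′ i) (r≗r′ j)
  opVal-cong (mul i j) r≗r′ = cong₂ _*_ (r≗r′ i) (r≗r′ j)

  _++_ : ∀ {k n n′} → Prog R k n → Prog R n n′ → Prog R k n′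
  p ++ start = p
  p ++ (q ▷ o) = (p ++ q) ▷ o

  run-++ : ∀ {k n n′} (p : Prog R k n) (q : Prog R n n′) r → run R (p ++ q) r ≗ run R q (run R p r)
  run-++ p start r i = refl
  run-++ p (q ▷ o) r = snocF-cong (run-++ p q r) (opVal-cong o (run-++ p q r))

  mulCount-++ : ∀ {k n n′} (p : Prog R k n) (q : Prog R n n′) →
    mulCount R (p ++ q) ≡ mulCount R p ℕ.+ mulCount R q
  mulCount-++ p start = ≡.sym (ℕₚ.+-identityʳ (mulCount R p))
  mulCount-++ p (q ▷ o) = ≡.trans (cong (ℕ._+ opMuls R o) (mulCount-++ p q)) (ℕₚ.+-assoc (mulCount R p) _ _)

  inject : ∀ {k n} → Prog R k n → Fin k → Fin n
  inject start i = i
  inject (q ▷ o) i = inject₁ (inject q i)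

  run-inject : ∀ {k n} (q : Prog R k n) r i → run R q r (inject q i) ≡ r i
  run-inject start r i = refl
  run-inject (q ▷ o) r i = ≡.trans (snocF-inject₁ (run R q r) _ (inject q i)) (run-inject q r i)

  map-run-inject : ∀ {k n d} (q : Prog R k n) r (xs : Vec (Fin k) d) →
    map (run R q r) (map (inject q) xs) ≡ map r xs
  map-run-inject q r xs = ≡.trans (≡.sym (Vecₚ.map-∘ _ _ xs)) (Vecₚ.map-cong (run-inject q r) xs)

  record Circuit {s} (n e b : ℕ) (Spec : (Fin n → Carrier) → Vec Carrier e → Set s) : Set (c ⊔ s) where
    field
      {size} : ℕ
      code : Prog R n size
      outs : Vec (Fin size) e
      muls : mulCount R code ≡ b
      sound : ∀ r → Spec r (map (run R code r) outs)

  -- Polynomials and the Taylor expansion at x² + x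

  horner : ∀ {d} → Vec Carrier d → Carrier → Carrier
  horner [] x = 0#
  horner (f₀ ∷ f) x = f₀ + x * horner f x

  horner-cong : ∀ {d} (f : Vec Carrier d) {x y} → x ≈ y → horner f x ≈ horner f y
  horner-cong [] x≈y = ≈-refl
  horner-cong (f₀ ∷ f) x≈y = +-congˡ (*-cong x≈y (horner-cong f x≈y))

  sumF-cong : ∀ n {g h : Fin n → Carrier} → (∀ j → g j ≈ h j) → sumF R n g ≈ sumF R n h
  sumF-cong zero g≈h = ≈-refl
  sumF-cong (suc n) g≈h = +-cong (g≈h Fin.zero) (sumF-cong n (g≈h ∘ Fin.suc))

  *-distribˡ-sumF : ∀ n x (g : Fin n → Carrier) → x * sumF R n g ≈ sumF R n (λ j → x * g j)
  *-distribˡ-sumF zero x g = zeroʳ x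
  *-distribˡ-sumF (suc n) x g = ≈-trans (distribˡ x _ _) (+-congˡ (*-distribˡ-sumF n x (g ∘ Fin.suc)))

  evalPoly≈horner : ∀ d (f : Fin d → Carrier) x → evalPoly R d f x ≈ horner (tabulate f) x
  evalPoly≈horner zero f x = ≈-refl
  evalPoly≈horner (suc d) f x = +-cong (*-identityʳ _) (begin
    sumF R d (λ j → f (Fin.suc j) * (x * pow R x (toℕ j))) ≈⟨ sumF-cong d (λ j → *-CS.x∙yz≈y∙xz (f (Fin.suc j)) x _) ⟩
    sumF R d (λ j → x * (f (Fin.suc j) * pow R x (toℕ j))) ≈⟨ ≈-sym (*-distribˡ-sumF d x _) ⟩
    x * evalPoly R d (f ∘ Fin.suc) x                       ≈⟨ *-congˡ (evalPoly≈horner d (f ∘ Fin.suc) x) ⟩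
    x * horner (tabulate (f ∘ Fin.suc)) x                  ∎)

  evalPoly-cong : ∀ d (f : Fin d → Carrier) {x y} → x ≈ y → evalPoly R d f x ≈ evalPoly R d f y
  evalPoly-cong d f x≈y =
    ≈-trans (evalPoly≈horner d f _) (≈-trans (horner-cong (tabulate f) x≈y) (≈-sym (evalPoly≈horner d f _)))

  carry : ∀ {d} → Carrier → Vec Carrier (dbl d) → Vec Carrier (suc (dbl d))
  carry {zero} w [] = w ∷ []
  carry {suc d} w (u ∷ v ∷ t) = (w + (u + v)) ∷ (u + v) ∷ carry v t

  -- The Taylor coefficients, interleaved: f(x) = Σⱼ (t_{2j} + t_{2j+1} x) (x² + x)ʲ.
  taylor : ∀ {d} → Vec Carrier (dbl d) → Vec Carrier (dbl d)
  taylor {zero} [] = []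
  taylor {suc d} (f₀ ∷ f₁ ∷ f) = f₀ ∷ carry f₁ (taylor f)

  butterflies : ∀ {d} → Vec Carrier d → Vec Carrier d → Vec Carrier d → Vec Carrier (dbl d)
  butterflies [] [] [] = []
  butterflies (x ∷ X) (u ∷ U) (w ∷ W) = (u + x * w) ∷ ((u + x * w) + w) ∷ butterflies X U W

  carryCircuit : ∀ {n d} (w : Fin n) (xs : Vec (Fin n) (dbl d)) →
    Circuit n (suc (dbl d)) 0 (λ r ys → ys ≡ carry (r w) (map r xs))
  carryCircuit {d = zero} w [] = record { code = start ; outs = w ∷ [] ; muls = refl ; sound = λ _ → refl }
  carryCircuit {n} {suc d} w (u ∷ v ∷ xs) = record
    { code = step ++ K.code
    ; outs = outs
    ; muls = ≡.trans (mulCount-++ step K.code) K.muls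
    ; sound = sound
    }
    where
    sum : Prog R n (suc n)
    sum = start ▷ add u v
    step : Prog R n (suc (suc n))
    step = sum ▷ add (inject₁ w) (fromℕ n)
    module K = Circuit (carryCircuit (inject step v) (map (inject step) xs))
    outs = inject K.code (fromℕ (suc n)) ∷ inject K.code (inject₁ (fromℕ n)) ∷ K.outs
    sound : ∀ r → map (run R (step ++ K.code) r) outs ≡ carry (r w) (map r (u ∷ v ∷ xs))
    sound r = ≡.trans (Vecₚ.map-cong (run-++ step K.code r) outs)
      (cong₂ _∷_ (≡.trans (run-inject K.code r₂ _) w+sum)
        (cong₂ _∷_ (≡.trans (run-inject K.code r₂ _) (≡.trans (snocF-inject₁ r₁ _ (fromℕ n)) (snocF-last r _)))
          (≡.trans (K.sound r₂) (cong₂ carry (run-inject step r v) (map-run-inject step r xs)))))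
      where
      r₁ = run R sum r
      r₂ = run R step r
      w+sum : r₂ (fromℕ (suc n)) ≡ r w + (r u + r v)
      w+sum = ≡.trans (snocF-last r₁ _) (cong₂ _+_ (run-inject sum r w) (snocF-last r _))

  taylorCircuit : ∀ {n d} (xs : Vec (Fin n) (dbl d)) → Circuit n (dbl d) 0 (λ r ys → ys ≡ taylor (map r xs))
  taylorCircuit {d = zero} [] = record { code = start ; outs = [] ; muls = refl ; sound = λ _ → refl }
  taylorCircuit {d = suc d} (x₀ ∷ x₁ ∷ xs) = record
    { code = T.code ++ K.code
    ; outs = inject K.code (inject T.code x₀) ∷ K.outs
    ; muls = ≡.trans (mulCount-++ T.code K.code) (cong₂ ℕ._+_ T.muls K.muls)
    ; sound = λ r → ≡.trans (Vecₚ.map-cong (run-++ T.code K.code r) _)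
        (cong₂ _∷_ (≡.trans (run-inject K.code _ _) (run-inject T.code r x₀))
          (≡.trans (K.sound _) (cong₂ carry (run-inject T.code r x₁) (T.sound r))))
    }
    where
    module T = Circuit (taylorCircuit xs)
    module K = Circuit (carryCircuit (inject T.code x₁) T.outs)

  butterflyCircuit : ∀ {n d} (X : Vec Carrier d) (us ws : Vec (Fin n) d) →
    Circuit n (dbl d) d (λ r ys → ys ≡ butterflies X (map r us) (map r ws))
  butterflyCircuit [] [] [] = record { code = start ; outs = [] ; muls = refl ; sound = λ _ → refl }
  butterflyCircuit {n} (x ∷ X) (u ∷ us) (w ∷ ws) = record
    { code = step ++ B.code
    ; outs = outs
    ; muls = ≡.trans (mulCount-++ step B.code) (cong suc B.muls)
    ; sound = sound
    }
    where
    p₁ : Prog R n (suc n)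
    p₁ = start ▷ const x
    p₂ : Prog R n (suc (suc n))
    p₂ = p₁ ▷ mul (fromℕ n) (inject₁ w)
    p₃ : Prog R n (suc (suc (suc n)))
    p₃ = p₂ ▷ add (inject₁ (inject₁ u)) (fromℕ (suc n))
    step : Prog R n (suc (suc (suc (suc n))))
    step = p₃ ▷ add (fromℕ (suc (suc n))) (inject₁ (inject₁ (inject₁ w)))
    module B = Circuit (butterflyCircuit X (map (inject step) us) (map (inject step) ws))
    outs = inject B.code (inject₁ (fromℕ (suc (suc n)))) ∷ inject B.code (fromℕ (suc (suc (suc n)))) ∷ B.outs
    sound : ∀ r → map (run R (step ++ B.code) r) outs ≡ butterflies (x ∷ X) (map r (u ∷ us)) (map r (w ∷ ws))
    sound r = ≡.trans (Vecₚ.map-cong (run-++ step B.code r) outs)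
      (cong₂ _∷_ (≡.trans (run-inject B.code r₄ _) (≡.trans (snocF-inject₁ r₃ _ (fromℕ (suc (suc n)))) even))
        (cong₂ _∷_ (≡.trans (run-inject B.code r₄ _) odd)
          (≡.trans (B.sound r₄) (cong₂ (butterflies X) (map-run-inject step r us) (map-run-inject step r ws)))))
      where
      r₁ = run R p₁ r
      r₂ = run R p₂ r
      r₃ = run R p₃ r
      r₄ = run R step r
      product : r₂ (fromℕ (suc n)) ≡ x * r w
      product = ≡.trans (snocF-last r₁ _) (cong₂ _*_ (snocF-last r x) (run-inject p₁ r w))
      even : r₃ (fromℕ (suc (suc n))) ≡ r u + x * r w
      even = ≡.trans (snocF-last r₂ _) (cong₂ _+_ (run-inject p₂ r u) product)
      odd : r₄ (fromℕ (suc (suc (suc n)))) ≡ (r u + x * r w) + r w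
      odd = ≡.trans (snocF-last r₃ _) (cong₂ _+_ even (run-inject p₃ r w))

  lincomb-cong : ∀ n cs {b b′} → (∀ t → b t ≈ b′ t) → lincomb R n cs b ≈ lincomb R n cs b′
  lincomb-cong zero cs b≈b′ = ≈-refl
  lincomb-cong (suc n) cs b≈b′ = +-cong (if-cong (cs Fin.zero)) (lincomb-cong n (cs ∘ Fin.suc) (b≈b′ ∘ Fin.suc))
    where
    if-cong : ∀ bit → (if bit then _ else 0#) ≈ (if bit then _ else 0#)
    if-cong true = b≈b′ Fin.zero
    if-cong false = ≈-refl

  varpi-0 : ∀ N β → varpi R N β 0 ≈ 0#
  varpi-0 zero β = ≈-refl
  varpi-0 (suc N) β = ≈-trans (+-identityˡ _) (varpi-0 N (β ∘ Fin.suc))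

  varpi-dbl : ∀ m b k → varpi R (suc m) b (dbl k) ≈ varpi R m (b ∘ Fin.suc) k
  varpi-dbl m b k =
    ≈-trans (reflexive (cong₂ (λ bit u → (if bit then b Fin.zero else 0#) + varpi R m (b ∘ Fin.suc) u)
                              (odd?-dbl k) (⌊dbl-n/2⌋≡n k)))
            (+-identityˡ _)

  varpi-1+dbl : ∀ m b k → varpi R (suc m) b (suc (dbl k)) ≈ b Fin.zero + varpi R m (b ∘ Fin.suc) k
  varpi-1+dbl m b k = reflexive (cong₂ (λ bit u → (if bit then b Fin.zero else 0#) + varpi R m (b ∘ Fin.suc) u)
                                       (odd?-1+dbl k) (⌊1+dbl-n/2⌋≡n k))

  coset-point-odd : ∀ m b → b Fin.zero ≈ 1# → ∀ a k →
    a + varpi R (suc m) b (suc (dbl k)) ≈ (a + varpi R m (b ∘ Fin.suc) k) + 1#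
  coset-point-odd m b b₀≈1 a k = begin
    a + varpi R (suc m) b (suc (dbl k))                ≈⟨ +-congˡ (varpi-1+dbl m b k) ⟩
    a + (b Fin.zero + varpi R m (b ∘ Fin.suc) k)       ≈⟨ +-congˡ (+-congʳ b₀≈1) ⟩
    a + (1# + varpi R m (b ∘ Fin.suc) k)               ≈⟨ +-CS.x∙yz≈xz∙y a 1# _ ⟩
    (a + varpi R m (b ∘ Fin.suc) k) + 1#               ∎

  varpi-truncate : ∀ {N} m (β : Fin N → Carrier) (m≤N : m ≤ N) u → u < pow2 m →
    varpi R N β u ≈ varpi R m (λ t → β (inject≤ t m≤N)) u
  varpi-truncate zero β _ zero _ = varpi-0 _ β
  varpi-truncate zero β _ (suc u) (s≤s ())
  varpi-truncate {suc N} (suc m) β m≤N u u<2ᵐ =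
    +-congˡ (varpi-truncate m (β ∘ Fin.suc) (ℕₚ.≤-pred m≤N) ⌊ u /2⌋ (m<dbl-n⇒⌊m/2⌋<n u (pow2 m) u<2ᵐ))

  module _ (char2 : Char2 R) where

    open import Data.Vec.Relation.Binary.Equality.Setoid setoid using (_≋_; ≋-trans)

    x+x≈0 : ∀ x → x + x ≈ 0#
    x+x≈0 x = begin
      x + x             ≈⟨ +-cong (≈-sym (*-identityʳ x)) (≈-sym (*-identityʳ x)) ⟩
      x * 1# + x * 1#   ≈⟨ ≈-sym (distribˡ x 1# 1#) ⟩
      x * (1# + 1#)     ≈⟨ *-congˡ char2 ⟩
      x * 0#            ≈⟨ zeroʳ x ⟩
      0#                ∎

    -x≈x : ∀ x → - x ≈ x
    -x≈x x = begin
      - x             ≈⟨ ≈-sym (+-identityʳ (- x)) ⟩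
      - x + 0#        ≈⟨ +-congˡ (≈-sym (x+x≈0 x)) ⟩
      - x + (x + x)   ≈⟨ ≈-sym (+-assoc (- x) x x) ⟩
      (- x + x) + x   ≈⟨ +-congʳ (-‿inverseˡ x) ⟩
      0# + x          ≈⟨ +-identityˡ x ⟩
      x               ∎

    cancel-double : ∀ {x y} d → x ≈ y + (d + d) → x ≈ y
    cancel-double {y = y} d x≈y+2d = ≈-trans x≈y+2d (≈-trans (+-congˡ (x+x≈0 d)) (+-identityʳ y))

    ℘ : Carrier → Carrier
    ℘ x = x * x + x

    ℘-0 : ℘ 0# ≈ 0#
    ℘-0 = ≈-trans (+-identityʳ _) (zeroˡ 0#)

    ℘-+ : ∀ x y → ℘ (x + y) ≈ ℘ x + ℘ y
    ℘-+ x y = cancel-double (x * y) (expand x y)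
      where
      expand : ∀ x y → (x + y) * (x + y) + (x + y) ≈ (x * x + x + (y * y + y)) + (x * y + x * y)
      expand = solve 2 (λ x y →
        (x :+ y) :* (x :+ y) :+ (x :+ y) := (x :* x :+ x :+ (y :* y :+ y)) :+ (x :* y :+ x :* y)) ≈-refl

    ℘-+1 : ∀ x → ℘ (x + 1#) ≈ ℘ x
    ℘-+1 x = begin
      ℘ (x + 1#)             ≈⟨ ℘-+ x 1# ⟩
      ℘ x + (1# * 1# + 1#)   ≈⟨ +-congˡ (≈-trans (+-congʳ (*-identityˡ 1#)) char2) ⟩
      ℘ x + 0#               ≈⟨ +-identityʳ _ ⟩
      ℘ x                    ∎

    ℘-if : ∀ bit x → ℘ (if bit then x else 0#) ≈ (if bit then ℘ x else 0#)
    ℘-if true x = ≈-refl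
    ℘-if false x = ℘-0

    ℘-lincomb : ∀ n cs b → ℘ (lincomb R n cs b) ≈ lincomb R n cs (℘ ∘ b)
    ℘-lincomb zero cs b = ℘-0
    ℘-lincomb (suc n) cs b =
      ≈-trans (℘-+ _ _) (+-cong (℘-if (cs Fin.zero) (b Fin.zero)) (℘-lincomb n (cs ∘ Fin.suc) (b ∘ Fin.suc)))

    -- b t is β_{t+1}: β₁ = 1 and β_{t+1}² − β_{t+1} = β_t.
    IsCantorSequence : (m : ℕ) → (Fin m → Carrier) → Set ℓ
    IsCantorSequence zero b = ⊤
    IsCantorSequence (suc m) b = (b Fin.zero ≈ 1#) × (∀ t → ℘ (b (Fin.suc t)) ≈ b (inject₁ t))

    IsCantorSequence-inject₁ : ∀ m b → IsCantorSequence (suc m) b → IsCantorSequence m (b ∘ inject₁)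
    IsCantorSequence-inject₁ zero b _ = _
    IsCantorSequence-inject₁ (suc m) b (b₀≈1 , ℘b≈b) = b₀≈1 , ℘b≈b ∘ inject₁

    IsCantorBasis⇒IsCantorSequence : ∀ {N} m (β : Fin N → Carrier) (m≤N : m ≤ N) →
      IsCantorBasis R N β → IsCantorSequence m (λ t → β (inject≤ t m≤N))
    IsCantorBasis⇒IsCantorSequence zero β _ _ = _
    IsCantorBasis⇒IsCantorSequence {suc N} (suc m) β m≤N (_ , β₀≈1 , ℘β≈β) = β₀≈1 (s≤s z≤n) , ℘β≈β′
      where
      β-at : ∀ {i j} → toℕ i ≡ toℕ j → β i ≡ β j
      β-at = cong β ∘ Finₚ.toℕ-injective
      ℘β≈β′ : ∀ t → ℘ (β (inject≤ (Fin.suc t) m≤N)) ≈ β (inject≤ (inject₁ t) m≤N)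
      ℘β≈β′ t = begin
        ℘ (β (inject≤ (Fin.suc t) m≤N))   ≡⟨ cong ℘ (β-at (≡.trans (Finₚ.toℕ-inject≤ (Fin.suc t) m≤N)
                                                              (≡.sym (Finₚ.toℕ-fromℕ< t+1<N)))) ⟩
        X * X + X                          ≈⟨ +-congˡ (≈-sym (-x≈x X)) ⟩
        X * X - X                          ≈⟨ ℘β≈β (toℕ t) t+1<N ⟩
        β (fromℕ< _)                       ≡⟨ β-at (≡.trans (Finₚ.toℕ-fromℕ< _)
                                                   (≡.sym (≡.trans (Finₚ.toℕ-inject≤ (inject₁ t) m≤N) (Finₚ.toℕ-inject₁ t)))) ⟩
        β (inject≤ (inject₁ t) m≤N)        ∎
        where
        t+1<N : suc (toℕ t) < suc N
        t+1<N = s≤s (ℕₚ.≤-trans (Finₚ.toℕ<n t) (ℕₚ.≤-pred m≤N))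
        X = β (fromℕ< t+1<N)

    ℘-coset : ∀ m b → IsCantorSequence (suc m) b →
      ∀ a u → ℘ (a + varpi R m (b ∘ Fin.suc) u) ≈ ℘ a + varpi R m (b ∘ inject₁) u
    ℘-coset m b (_ , ℘b≈b) a u =
      ≈-trans (℘-+ a _) (+-congˡ (≈-trans (℘-lincomb m _ _) (lincomb-cong m _ ℘b≈b)))

    evens-carry : ∀ {d} w v (t : Vec Carrier (dbl d)) y →
      horner (evens (w ∷ carry v t)) y ≈ w + y * (horner (evens t) y + horner (odds t) y)
    evens-carry {zero} w v [] y = +-congˡ (*-congˡ (≈-sym (+-identityʳ 0#)))
    evens-carry {suc d} w v (u₀ ∷ v₀ ∷ t) y = begin
      w + y * horner (evens ((u₀ + v₀) ∷ carry v₀ t)) y  ≈⟨ +-congˡ (*-congˡ (evens-carry (u₀ + v₀) v₀ t y)) ⟩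
      w + y * ((u₀ + v₀) + y * (E + O))                   ≈⟨ regroup w y u₀ v₀ E O ⟩
      w + y * ((u₀ + y * E) + (v₀ + y * O))               ∎
      where
      E = horner (evens t) y
      O = horner (odds t) y
      regroup : ∀ w y u v E O → w + y * ((u + v) + y * (E + O)) ≈ w + y * ((u + y * E) + (v + y * O))
      regroup = solve 6 (λ w y u v E O →
        w :+ y :* ((u :+ v) :+ y :* (E :+ O)) := w :+ y :* ((u :+ y :* E) :+ (v :+ y :* O))) ≈-refl

    odds-carry : ∀ {d} w v (t : Vec Carrier (dbl d)) y →
      horner (odds (w ∷ carry v t)) y ≈ v + ((horner (evens t) y + horner (odds t) y) + y * horner (odds t) y)
    odds-carry {zero} w v [] y = +-congˡ (≈-sym (≈-trans (+-congʳ (+-identityʳ 0#)) (+-identityˡ _)))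
    odds-carry {suc d} w v (u₀ ∷ v₀ ∷ t) y = begin
      (v + (u₀ + v₀)) + y * horner (odds ((u₀ + v₀) ∷ carry v₀ t)) y  ≈⟨ +-congˡ (*-congˡ (odds-carry (u₀ + v₀) v₀ t y)) ⟩
      (v + (u₀ + v₀)) + y * (v₀ + ((E + O) + y * O))                  ≈⟨ regroup v y u₀ v₀ E O ⟩
      v + (((u₀ + y * E) + (v₀ + y * O)) + y * (v₀ + y * O))          ∎
      where
      E = horner (evens t) y
      O = horner (odds t) y
      regroup : ∀ v y u w E O →
        (v + (u + w)) + y * (w + ((E + O) + y * O)) ≈ v + (((u + y * E) + (w + y * O)) + y * (w + y * O))
      regroup = solve 6 (λ v y u w E O →
        (v :+ (u :+ w)) :+ y :* (w :+ ((E :+ O) :+ y :* O))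
          := v :+ (((u :+ y :* E) :+ (w :+ y :* O)) :+ y :* (w :+ y :* O))) ≈-refl

    taylor-split : ∀ {d} (f : Vec Carrier (dbl d)) x →
      horner f x ≈ horner (evens (taylor f)) (℘ x) + x * horner (odds (taylor f)) (℘ x)
    taylor-split {zero} [] x = ≈-sym (≈-trans (+-identityˡ _) (zeroʳ x))
    taylor-split {suc d} (f₀ ∷ f₁ ∷ f) x = begin
      f₀ + x * (f₁ + x * horner f x)
        ≈⟨ +-congˡ (*-congˡ (+-congˡ (*-congˡ (taylor-split f x)))) ⟩
      f₀ + x * (f₁ + x * (E + x * O))
        ≈⟨ ≈-sym (cancel-double (x * E + x * x * O + x * O) (expand f₀ f₁ x E O)) ⟩
      (f₀ + ℘ x * (E + O)) + x * (f₁ + ((E + O) + ℘ x * O))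
        ≈⟨ ≈-sym (+-cong (evens-carry f₀ f₁ (taylor f) (℘ x)) (*-congˡ (odds-carry f₀ f₁ (taylor f) (℘ x)))) ⟩
      horner (evens (taylor (f₀ ∷ f₁ ∷ f))) (℘ x) + x * horner (odds (taylor (f₀ ∷ f₁ ∷ f))) (℘ x) ∎
      where
      E = horner (evens (taylor f)) (℘ x)
      O = horner (odds (taylor f)) (℘ x)
      expand : ∀ f₀ f₁ x E O →
        (f₀ + (x * x + x) * (E + O)) + x * (f₁ + ((E + O) + (x * x + x) * O))
          ≈ (f₀ + x * (f₁ + x * (E + x * O))) + ((x * E + x * x * O + x * O) + (x * E + x * x * O + x * O))
      expand = solve 5 (λ f₀ f₁ x E O →
        (f₀ :+ (x :* x :+ x) :* (E :+ O)) :+ x :* (f₁ :+ ((E :+ O) :+ (x :* x :+ x) :* O))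
          := (f₀ :+ x :* (f₁ :+ x :* (E :+ x :* O)))
             :+ ((x :* E :+ x :* x :* O :+ x :* O) :+ (x :* E :+ x :* x :* O :+ x :* O))) ≈-refl

    -- The additive FFT

    butterflies-correct : ∀ {d e} (f : Vec Carrier d) (g₀ g₁ : Vec Carrier e) →
      (∀ x → horner f x ≈ horner g₀ (℘ x) + x * horner g₁ (℘ x)) →
      ∀ {n} (X U W : Vec Carrier n) → U ≋ map (horner g₀ ∘ ℘) X → W ≋ map (horner g₁ ∘ ℘) X →
      butterflies X U W ≋ interleave (map (horner f) X) (map (λ x → horner f (x + 1#)) X)
    butterflies-correct f g₀ g₁ split [] [] [] [] [] = []
    butterflies-correct f g₀ g₁ split (x ∷ X) (u ∷ U) (w ∷ W) (u≈ ∷ U≈) (w≈ ∷ W≈) =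
      at-x ∷ at-x+1 ∷ butterflies-correct f g₀ g₁ split X U W U≈ W≈
      where
      G₀ = horner g₀ (℘ x)
      G₁ = horner g₁ (℘ x)
      at-x : u + x * w ≈ horner f x
      at-x = ≈-trans (+-cong u≈ (*-congˡ w≈)) (≈-sym (split x))
      at-x+1 : (u + x * w) + w ≈ horner f (x + 1#)
      at-x+1 = begin
        (u + x * w) + w                                             ≈⟨ +-cong (+-cong u≈ (*-congˡ w≈)) w≈ ⟩
        (G₀ + x * G₁) + G₁                                          ≈⟨ +-congˡ (≈-sym (*-identityˡ G₁)) ⟩
        (G₀ + x * G₁) + 1# * G₁                                     ≈⟨ +-assoc G₀ _ _ ⟩
        G₀ + (x * G₁ + 1# * G₁)                                     ≈⟨ +-congˡ (≈-sym (distribʳ G₁ x 1#)) ⟩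
        G₀ + (x + 1#) * G₁                                          ≈⟨ +-cong (horner-cong g₀ (≈-sym (℘-+1 x)))
                                                                             (*-congˡ (horner-cong g₁ (≈-sym (℘-+1 x)))) ⟩
        horner g₀ (℘ (x + 1#)) + (x + 1#) * horner g₁ (℘ (x + 1#)) ≈⟨ ≈-sym (split (x + 1#)) ⟩
        horner f (x + 1#)                                           ∎

    fft-step : ∀ m b → IsCantorSequence (suc m) b → ∀ {d} n a (f : Vec Carrier (dbl d)) {U W : Vec Carrier n} →
      U ≋ sample n (λ u → horner (evens (taylor f)) (℘ a + varpi R m (b ∘ inject₁) u)) →
      W ≋ sample n (λ u → horner (odds (taylor f)) (℘ a + varpi R m (b ∘ inject₁) u)) →
      butterflies (sample n (λ k → a + varpi R m (b ∘ Fin.suc) k)) U W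
        ≋ sample (dbl n) (λ u → horner f (a + varpi R (suc m) b u))
    fft-step m b cantor n a f {U} {W} U≈ W≈ =
      ≋-trans (butterflies-correct f (evens (taylor f)) (odds (taylor f)) (taylor-split f) X U W
                                   (on-℘X (evens (taylor f)) U≈) (on-℘X (odds (taylor f)) W≈))
              points
      where
      q p : ℕ → Carrier
      q k = a + varpi R m (b ∘ Fin.suc) k
      p u = a + varpi R (suc m) b u
      X = sample n q
      on-℘X : ∀ {e} (g : Vec Carrier e) {V} → V ≋ sample n (λ u → horner g (℘ a + varpi R m (b ∘ inject₁) u)) →
        V ≋ map (horner g ∘ ℘) X
      on-℘X g V≈ rewrite map-sample n (horner g ∘ ℘) q =
        ≋-trans V≈ (sample⁺ n {q = horner g ∘ ℘ ∘ q} (λ k → horner-cong g (≈-sym (℘-coset m b cantor a k))))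
      points : interleave (map (horner f) X) (map (λ x → horner f (x + 1#)) X) ≋ sample (dbl n) (horner f ∘ p)
      points rewrite map-sample n (horner f) q | map-sample n (λ x → horner f (x + 1#)) q
                   | sample-dbl n (horner f ∘ p) =
        interleave⁺ (sample⁺ n {q = horner f ∘ p ∘ dbl}
                             (λ k → horner-cong f (≈-sym (+-congˡ (varpi-dbl m b k)))))
                    (sample⁺ n {q = horner f ∘ p ∘ suc ∘ dbl}
                             (λ k → horner-cong f (≈-sym (coset-point-odd m b (proj₁ cantor) a k))))

    fftCircuit : ∀ {n} m a b → IsCantorSequence m b → (xs : Vec (Fin n) (pow2 m)) →
      Circuit n (pow2 m) (fftCost m) (λ r ys → ys ≋ sample (pow2 m) (λ u → horner (map r xs) (a + varpi R m b u)))
    fftCircuit zero a b _ (x ∷ []) = record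
      { code = start ; outs = x ∷ [] ; muls = refl
      ; sound = λ r → ≈-sym (≈-trans (+-congˡ (zeroʳ _)) (+-identityʳ _)) ∷ []
      }
    fftCircuit (suc m) a b cantor xs = record
      { code = T.code ++ EOB
      ; outs = B.outs
      ; muls = ≡.trans (mulCount-++ T.code EOB) (cong₂ ℕ._+_ T.muls
                 (≡.trans (mulCount-++ E.code OB) (cong₂ ℕ._+_ E.muls
                   (≡.trans (mulCount-++ O.code B.code) (cong₂ ℕ._+_ O.muls B.muls)))))
      ; sound = sound
      }
      where
      cantor′ = IsCantorSequence-inject₁ m b cantor
      X = sample (pow2 m) (λ k → a + varpi R m (b ∘ Fin.suc) k)
      module T = Circuit (taylorCircuit xs)
      module E = Circuit (fftCircuit m (℘ a) (b ∘ inject₁) cantor′ (evens T.outs))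
      module O = Circuit (fftCircuit m (℘ a) (b ∘ inject₁) cantor′ (map (inject E.code) (odds T.outs)))
      module B = Circuit (butterflyCircuit X (map (inject O.code) E.outs) O.outs)
      OB = O.code ++ B.code
      EOB = E.code ++ OB
      sound : ∀ r → map (run R (T.code ++ EOB) r) B.outs
                      ≋ sample (pow2 (suc m)) (λ u → horner (map r xs) (a + varpi R (suc m) b u))
      sound r = ≡.subst (_≋ _) (≡.sym outputs)
                  (fft-step m b cantor (pow2 m) a (map r xs)
                    (≡.subst (λ g → map r₂ E.outs ≋ sample (pow2 m) (horner g ∘ ℘a+ϖ)) evens≡ (E.sound r₁))
                    (≡.subst (λ g → map r₃ O.outs ≋ sample (pow2 m) (horner g ∘ ℘a+ϖ)) odds≡ (O.sound r₂)))
        where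
        ℘a+ϖ = λ u → ℘ a + varpi R m (b ∘ inject₁) u
        r₁ = run R T.code r
        r₂ = run R E.code r₁
        r₃ = run R O.code r₂
        outputs : map (run R (T.code ++ EOB) r) B.outs ≡ butterflies X (map r₂ E.outs) (map r₃ O.outs)
        outputs = ≡.trans (Vecₚ.map-cong (λ i → ≡.trans (run-++ T.code EOB r i)
                                                 (≡.trans (run-++ E.code OB r₁ i) (run-++ O.code B.code r₂ i))) B.outs)
                  (≡.trans (B.sound r₃) (cong (λ V → butterflies X V (map r₃ O.outs)) (map-run-inject O.code r₂ E.outs)))
        evens≡ : map r₁ (evens T.outs) ≡ evens (taylor (map r xs))
        evens≡ = ≡.trans (map-evens r₁ T.outs) (cong evens (T.sound r))
        odds≡ : map r₂ (map (inject E.code) (odds T.outs)) ≡ odds (taylor (map r xs))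
        odds≡ = ≡.trans (map-run-inject E.code r₁ _) (≡.trans (map-odds r₁ T.outs) (cong odds (T.sound r)))

    additive-fft : ∀ m a b → IsCantorSequence m b →
      Σ ℕ λ n → Σ (Prog R (pow2 m) n) λ P → Σ (Fin (pow2 m) → Fin n) λ out →
        (mulCount R P ≡ fftCost m)
        × (∀ f i → run R P f (out i) ≈ evalPoly R (pow2 m) f (a + varpi R m b (toℕ i)))
    additive-fft m a b cantor = C.size , C.code , Vec.lookup C.outs , C.muls , evaluates
      where
      module C = Circuit (fftCircuit m a b cantor (allFin (pow2 m)))
      evaluates : ∀ f i → run R C.code f (Vec.lookup C.outs i) ≈ evalPoly R (pow2 m) f (a + varpi R m b (toℕ i))
      evaluates f i = begin
        run R C.code f (Vec.lookup C.outs i)               ≡⟨ ≡.sym (Vecₚ.lookup-map i _ C.outs) ⟩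
        Vec.lookup (map (run R C.code f) C.outs) i         ≈⟨ Pointwise.lookup (C.sound f) i ⟩
        Vec.lookup (sample (pow2 m) (horner fs ∘ pt)) i    ≡⟨ Vecₚ.lookup∘tabulate _ i ⟩
        horner fs (pt (toℕ i))                             ≡⟨ cong (λ g → horner g (pt (toℕ i))) (≡.sym (Vecₚ.tabulate-allFin f)) ⟩
        horner (tabulate f) (pt (toℕ i))                   ≈⟨ ≈-sym (evalPoly≈horner (pow2 m) f _) ⟩
        evalPoly R (pow2 m) f (pt (toℕ i))                 ∎
        where
        fs = map f (allFin (pow2 m))
        pt = λ u → a + varpi R m b u

open import Data.Nat using (_*_; _^_; _∸_)

theorem2p5 : ∀ {c ℓ : Level} (R : CommutativeRing c ℓ) → IsField R → Char2 R →
    (L m : ℕ) → 1 ≤ L → 1 ≤ m → m ≤ 2 ^ L →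
    (β : Fin (2 ^ L) → CommutativeRing.Carrier R) → IsCantorBasis R (2 ^ L) β →
    (a : CommutativeRing.Carrier R) → W R (2 ^ L) β (2 ^ L) a → ¬ W R (2 ^ L) β m a →
    Σ ℕ (λ n → Σ (Prog R (2 ^ m) n) (λ P → Σ (Fin (2 ^ m) → Fin n) (λ out →
      (mulCount R P ≤ 2 ^ (m ∸ 1) * m)
      × (∀ (f : Fin (2 ^ m) → CommutativeRing.Carrier R) (i : Fin (2 ^ m)) →
           CommutativeRing._≈_ R (run R P f (out i))
             (evalPoly R (2 ^ m) f (CommutativeRing._+_ R a (varpi R (2 ^ L) β (toℕ i))))))))
theorem2p5 R _ char2 L m _ _ m≤N β cantor a _ _ rewrite ≡.sym (pow2≡2^ m)
  with additive-fft R char2 m a (λ t → β (inject≤ t m≤N)) (IsCantorBasis⇒IsCantorSequence R char2 m β m≤N cantor)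
... | n , P , out , muls , evaluates =
  n , P , out , ℕₚ.≤-reflexive (≡.trans muls (fftCost≡ m)) ,
  λ f i → trans (evaluates f i)
                (evalPoly-cong R (pow2 m) f (+-congˡ (sym (varpi-truncate R m β m≤N (toℕ i) (Finₚ.toℕ<n i)))))
  where open CommutativeRing R using (trans; sym; +-congˡ)
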